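{- Let $\mathcal{F}$ be a fluxing structure, $f\in F$, and let $\phi(x)$ be a property such that $f$ is imperceptibly changing with respect to $\phi$. Let $i\in I$ and $t,s\in W_i(f)$ with $t<s$. If $i$ changes his view with respect to $\phi$ between $t$ and $s$, i.e. either ($\mathcal{F},i,t\Vdash\phi(f)$ and $\mathcal{F},i,s\Vdash\neg\phi(f)$) or ($\mathcal{F},i,t\Vdash\neg\phi(f)$ and $\mathcal{F},i,s\Vdash\phi(f)$), then there is a watching gap between $t$ and $s$, i.e. there exists $t'\in\mathbb{N}$ with $t<t'<s$ and $f(i,t')$ undefined.
   Context: Let $L=\langle P_1,P_2,\ldots\rangle$ be a first-order relational language and $\mathcal{A}=\langle A,R_1,R_2,\ldots\rangle$ an $L$-structure ($R_k\subseteq A^{n_k}$ interprets $P_k$). Fix a nonempty set $I$ of agents; time is $\langle\mathbb{N},<\rangle$. $Fin(A^{I\times\mathbb{N}})$ is the set of all finite partial functions $f$ with $dom(f)\subseteq I\times\mathbb{N}$, $rng(f)\subseteq A$; write $f(i,t)\!\downarrow$ if $\langle i,t\rangle\in dom(f)$. A fluxing structure over $\mathcal{A}$ is $\mathcal{F}=\langle F,R_1,R_2,\ldots\rangle$ with $F\subseteq Fin(A^{I\times\mathbb{N}})$ such that distinct elements of $F$ have disjoint ranges. For $f\in F$, $i\in I$, $W_i(f)=\{t\in\mathbb{N}:\langle i,t\rangle\in dom(f)\}$. Sentences of $L(F)$ are built from atomic sentences $P_k(f_1,\ldots,f_{n_k})$ ($f_l\in F$) by $\wedge,\vee,\neg$;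 a property $\phi(x)$ is such a formula in which some argument places may be the variable $x$, and $\phi(f)$ is the result of substituting $f$ for $x$. The relation $\mathcal{F},i,t\Vdash\phi$ (also written $\langle i,t\rangle\Vdash\phi$) is defined inductively: (a) $\Vdash P_k(f_1,\ldots,f_{n_k})$ iff all $f_l(i,t)$ are defined and $\langle f_1(i,t),\ldots,f_{n_k}(i,t)\rangle\in R_k$; (b) $\Vdash\neg P_k(f_1,\ldots,f_{n_k})$ iff all $f_l(i,t)$ are defined and the tuple is not in $R_k$; (c) $\Vdash\phi\wedge\psi$ iff $\Vdash\phi$ and $\Vdash\psi$; (d) $\Vdash\phi\vee\psi$ iff $\Vdash\phi$ or $\Vdash\psi$; (e) $\Vdash\neg(\phi\wedge\psi)$ iff $\Vdash\neg\phi\vee\neg\psi$; (f) $\Vdash\neg(\phi\vee\psi)$ iff $\Vdash\neg\phi\wedge\neg\psi$; (g) $\Vdash\neg\neg\phi$ iff $\Vdash\phi$. The object $f$ is imperceptibly changing with respect to $\phi$ if for all $i\in I$ and $t\in\mathbb{N}$: if $f(i,t)\!\downarrow$ and $f(i,t+1)\!\downarrow$ then ($\langle i,t\rangle\Vdash\phi(f)\iff\langle i,t+1\rangle\Vdash\phi(f)$). -}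

module Defs where

open import Data.Nat using (ℕ; suc)
open import Data.Maybe using (Maybe; just; nothing)
open import Data.List using (List)
open import Data.List.Membership.Propositional using (_∈_)
open import Data.Vec using (Vec; []; _∷_)
open import Data.Product using (Σ; ∃; _×_; _,_; proj₁)
open import Data.Sum using (_⊎_)
open import Data.Empty using (⊥)
open import Relation.Nullary using (¬_)
open import Relation.Binary.PropositionalEquality using (_≡_)

record Structure : Set₁ where
  field
    Sym   : Set
    arity : Sym → ℕ
    A     : Set
    R     : (k : Sym) → Vec A (arity k) → Set

record FinPFun (A I : Set) : Set where
  field
    app    : I → ℕ → Maybe A
    finite : Σ (List (I × ℕ)) λ D →
               ∀ i t a → app i t ≡ just a → (i , t) ∈ D
open FinPFun public

module _ {A I : Set} where
  _↓⟨_,_⟩ : FinPFun A I → I → ℕ → Set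
  f ↓⟨ i , t ⟩ = ∃ λ a → app f i t ≡ just a

  InRange : A → FinPFun A I → Set
  InRange a f = ∃ λ i → ∃ λ t → app f i t ≡ just a

  SameFun : FinPFun A I → FinPFun A I → Set
  SameFun f g = ∀ i t → app f i t ≡ app g i t

  _∈W⟨_,_⟩ : ℕ → I → FinPFun A I → Set
  t ∈W⟨ i , f ⟩ = f ↓⟨ i , t ⟩

record Fluxing (𝒜 : Structure) (I : Set) : Set₁ where
  open Structure 𝒜
  field
    F        : FinPFun A I → Set
    disjoint : ∀ f g → F f → F g → ¬ SameFun f g →
               ∀ a → InRange a f → InRange a g → ⊥

module _ {𝒜 : Structure} {I : Set} (𝓕 : Fluxing 𝒜 I) where
  open Structure 𝒜
  open Fluxing 𝓕

  Obj : Set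
  Obj = Σ (FinPFun A I) F

module _ (𝒜 : Structure) where
  open Structure 𝒜

  data Formula (T : Set) : Set where
    atom : (k : Sym) → Vec T (arity k) → Formula T
    _∧'_ : Formula T → Formula T → Formula T
    _∨'_ : Formula T → Formula T → Formula T
    ¬'_  : Formula T → Formula T

-- Argument places of a property φ(x): either the variable x or an object.
data PTerm (O : Set) : Set where
  var : PTerm O
  obj : O → PTerm O

module _ {𝒜 : Structure} {I : Set} (𝓕 : Fluxing 𝒜 I) where
  open Structure 𝒜

  Sentence : Set
  Sentence = Formula 𝒜 (Obj 𝓕)

  Property : Set
  Property = Formula 𝒜 (PTerm (Obj 𝓕))

  private
    substT : Obj 𝓕 → PTerm (Obj 𝓕) → Obj 𝓕
    substT f var     = f
    substT f (obj g) = g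

    substV : ∀ {n} → Obj 𝓕 → Vec (PTerm (Obj 𝓕)) n → Vec (Obj 𝓕) n
    substV f []       = []
    substV f (u ∷ us) = substT f u ∷ substV f us

  subst : Property → Obj 𝓕 → Sentence
  subst (atom k us) f = atom k (substV f us)
  subst (φ ∧' ψ) f    = subst φ f ∧' subst ψ f
  subst (φ ∨' ψ) f    = subst φ f ∨' subst ψ f
  subst (¬' φ) f      = ¬' subst φ f

  private
    consM : ∀ {n} → Maybe A → Maybe (Vec A n) → Maybe (Vec A (suc n))
    consM (just a) (just as) = just (a ∷ as)
    consM _        _         = nothing

  values : I → ℕ → ∀ {n} → Vec (Obj 𝓕) n → Maybe (Vec A n)
  values i t []       = just []
  values i t (f ∷ fs) = consM (app (proj₁ f) i t) (values i t fs)

  -- 𝓕, i, t ⊩ φ   (Forces)  and   𝓕, i, t ⊩ ¬φ   (ForcesNeg), clauses (a)-(g)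
  Forces    : I → ℕ → Sentence → Set
  ForcesNeg : I → ℕ → Sentence → Set
  Forces i t (atom k fs) = ∃ λ as → values i t fs ≡ just as × R k as
  Forces i t (φ ∧' ψ)    = Forces i t φ × Forces i t ψ
  Forces i t (φ ∨' ψ)    = Forces i t φ ⊎ Forces i t ψ
  Forces i t (¬' φ)      = ForcesNeg i t φ
  ForcesNeg i t (atom k fs) = ∃ λ as → values i t fs ≡ just as × ¬ R k as
  ForcesNeg i t (φ ∧' ψ)    = ForcesNeg i t φ ⊎ ForcesNeg i t ψ
  ForcesNeg i t (φ ∨' ψ)    = ForcesNeg i t φ × ForcesNeg i t ψ
  ForcesNeg i t (¬' φ)      = Forces i t φ

  ImperceptiblyChanging : Obj 𝓕 → Property → Set
  ImperceptiblyChanging f φ =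
    ∀ i t → proj₁ f ↓⟨ i , t ⟩ → proj₁ f ↓⟨ i , suc t ⟩ →
      (Forces i t (subst φ f) → Forces i (suc t) (subst φ f)) ×
      (Forces i (suc t) (subst φ f) → Forces i t (subst φ f))

{-# OPTIONS --safe #-}
module Submission where

-- Without a watching gap between t and s, imperceptible change carries the
-- truth of φ(f) from each watched moment to the next, so i forces φ(f) at t
-- exactly when he forces it at s. A change of view would then make i force
-- both φ(f) and ¬φ(f) at one moment, which is impossible.

open import Defs
open import Data.Nat using (ℕ; suc; _<_)
open import Data.Nat.Properties using (m<1+n⇒m<n∨m≡n; m<n⇒m<1+n; n<1+n)
open import Data.Maybe using (just; nothing)
open import Data.Maybe.Properties using (just-injective)
open import Data.Product using (∃; _×_; _,_; proj₁; uncurry)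
open import Data.Sum using (_⊎_; inj₁; inj₂; [_,_])
open import Data.Empty using (⊥-elim)
open import Function.Bundles using (_⇔_; mk⇔; Equivalence)
open import Function.Construct.Composition using (_⇔-∘_)
open import Relation.Nullary using (¬_; yes; no)
open import Relation.Unary using (Decidable)
open import Relation.Binary.PropositionalEquality using (refl; sym; trans)

Gap : (ℕ → Set) → ℕ → ℕ → Set
Gap D t s = ∃ λ t′ → t < t′ × t′ < s × ¬ D t′

Gap-extendʳ : ∀ {D t s} → Gap D t s → Gap D t (suc s)
Gap-extendʳ (t′ , t<t′ , t′<s , ¬Dt′) = t′ , t<t′ , m<n⇒m<1+n t′<s , ¬Dt′

Gap⊎⇔ : ∀ {D P : ℕ → Set} → Decidable D →
        (∀ u → D u → D (suc u) → P u ⇔ P (suc u)) →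
        ∀ {t s} → D t → t < s → D s → Gap D t s ⊎ (P t ⇔ P s)
Gap⊎⇔ D? step {t} {suc s} Dt t<1+s D1+s with m<1+n⇒m<n∨m≡n t<1+s
... | inj₂ refl = inj₂ (step t Dt D1+s)
... | inj₁ t<s with D? s
...   | no ¬Ds = inj₁ (s , t<s , n<1+n s , ¬Ds)
...   | yes Ds with Gap⊎⇔ D? step Dt t<s Ds
...     | inj₁ gap   = inj₁ (Gap-extendʳ gap)
...     | inj₂ Pt⇔Ps = inj₂ (step s Ds D1+s ⇔-∘ Pt⇔Ps)

↓? : ∀ {A I : Set} (g : FinPFun A I) i → Decidable (g ↓⟨ i ,_⟩)
↓? g i t with app g i t
... | just a  = yes (a , refl)
... | nothing = no λ ()

module _ {𝒜 : Structure} {I : Set} (𝓕 : Fluxing 𝒜 I) where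

  Forces⇒¬ForcesNeg : ∀ {i t} (φ : Sentence 𝓕) →
                      Forces 𝓕 i t φ → ¬ ForcesNeg 𝓕 i t φ
  Forces⇒¬ForcesNeg (atom k fs) (as , vs≡as , Ras) (bs , vs≡bs , ¬Rbs)
    with just-injective (trans (sym vs≡as) vs≡bs)
  ... | refl = ¬Rbs Ras
  Forces⇒¬ForcesNeg (φ ∧' ψ) (⊩φ , _) (inj₁ ⊩¬φ) = Forces⇒¬ForcesNeg φ ⊩φ ⊩¬φ
  Forces⇒¬ForcesNeg (φ ∧' ψ) (_ , ⊩ψ) (inj₂ ⊩¬ψ) = Forces⇒¬ForcesNeg ψ ⊩ψ ⊩¬ψ
  Forces⇒¬ForcesNeg (φ ∨' ψ) (inj₁ ⊩φ) (⊩¬φ , _) = Forces⇒¬ForcesNeg φ ⊩φ ⊩¬φ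
  Forces⇒¬ForcesNeg (φ ∨' ψ) (inj₂ ⊩ψ) (_ , ⊩¬ψ) = Forces⇒¬ForcesNeg ψ ⊩ψ ⊩¬ψ
  Forces⇒¬ForcesNeg (¬' φ) ⊩¬φ ⊩φ = Forces⇒¬ForcesNeg φ ⊩φ ⊩¬φ

proposition3p3 : (𝒜 : Structure) (I : Set) (𝓕 : Fluxing 𝒜 I)
    (f : Obj 𝓕) (φ : Property 𝓕) →
    ImperceptiblyChanging 𝓕 f φ →
    (i : I) (t s : ℕ) →
    t ∈W⟨ i , proj₁ f ⟩ → s ∈W⟨ i , proj₁ f ⟩ → t < s →
    (Forces 𝓕 i t (subst 𝓕 φ f) × Forces 𝓕 i s (¬' (subst 𝓕 φ f)))
      ⊎ (Forces 𝓕 i t (¬' (subst 𝓕 φ f)) × Forces 𝓕 i s (subst 𝓕 φ f)) →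
    ∃ λ t′ → t < t′ × t′ < s × ¬ (proj₁ f ↓⟨ i , t′ ⟩)
proposition3p3 𝒜 I 𝓕 f φ unchanging i t s t∈W s∈W t<s viewChange
  with Gap⊎⇔ (↓? (proj₁ f) i) (λ u Du Du+1 → uncurry mk⇔ (unchanging i u Du Du+1))
             t∈W t<s s∈W
... | inj₁ gap   = gap
... | inj₂ ⊩t⇔⊩s = ⊥-elim ([ turnsFalse , turnsTrue ] viewChange)
  where
    open Equivalence ⊩t⇔⊩s
    turnsFalse : ¬ (Forces 𝓕 i t (subst 𝓕 φ f) × Forces 𝓕 i s (¬' (subst 𝓕 φ f)))
    turnsFalse (⊩t , ⊩¬s) = Forces⇒¬ForcesNeg 𝓕 (subst 𝓕 φ f) (to ⊩t) ⊩¬s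
    turnsTrue : ¬ (Forces 𝓕 i t (¬' (subst 𝓕 φ f)) × Forces 𝓕 i s (subst 𝓕 φ f))
    turnsTrue (⊩¬t , ⊩s) = Forces⇒¬ForcesNeg 𝓕 (subst 𝓕 φ f) (from ⊩s) ⊩¬t
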